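{- (1) For integers $m,n\geq 3$, $\gamma_{P,c}(K_m\times K_n)=\gamma_P(K_m\times K_n)=2$. (2) For integers $a\geq 1$, $b\geq 1$ and positive integers $m_1,\dots,m_a,n_1,\dots,n_b$, $$\gamma_{P,c}(K_{1,1,m_1,\dots,m_a}\times K_{1,1,n_1,\dots,n_b})=\gamma_P(K_{1,1,m_1,\dots,m_a}\times K_{1,1,n_1,\dots,n_b})=2.$$
   Context: Power domination: for $S\subseteq V(X)$, start with $M(S)=N[S]$ and repeatedly add a vertex $w$ whenever some $v\in M(S)$ has $w$ as its unique neighbour outside $M(S)$; $S$ is a power dominating set if the final $M(S)$ is $V(X)$, and a connected power dominating set if moreover $\langle S\rangle$ is connected. $\gamma_P(X)$ and $\gamma_{P,c}(X)$ are the respective minimum sizes. The tensor product $G\times H$ has vertex set $V(G)\times V(H)$, with $(a,b)\sim(x,y)$ iff $ax\in E(G)$ and $by\in E(H)$. $K_{p_1,\dots,p_k}$ denotes the complete multipartite graph with partite sets of sizes $p_1,\dots,p_k$; $K_n$ is the complete graph. -}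

module Defs where

open import Level using (0ℓ)
open import Data.Nat using (ℕ; zero; suc; _≤_)
open import Data.Fin using (Fin; zero; suc)
open import Data.Sum using (_⊎_)
open import Data.Product using (Σ; _×_; _,_; proj₁; proj₂)
open import Data.List using (List; length)
open import Data.List.Membership.Propositional using (_∈_)
open import Data.List.Relation.Unary.Unique.Propositional using (Unique)
open import Relation.Binary.PropositionalEquality using (_≡_; _≢_)
open import Relation.Nullary using (¬_)

record Graph : Set₁ where
  field
    V   : Set
    _~_ : V → V → Set
open Graph public

module _ (X : Graph) where
  private
    U = V X
    _∼_ = _~_ X

  InClosedNbhd : List U → U → Set
  InClosedNbhd S v = (v ∈ S) ⊎ (Σ U λ s → s ∈ S × s ∼ v)

  -- The final monitored set M(S) of the power-domination process,
  -- as the least set containing N[S] closed under the propagation rule: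
  -- if v ∈ M and w is the unique neighbour of v outside M, add w.
  data Observed (S : List U) : U → Set where
    start : ∀ {v} → InClosedNbhd S v → Observed S v
    force : ∀ {v w} → Observed S v → v ∼ w →
            (∀ u → v ∼ u → u ≢ w → Observed S u) → Observed S w

  -- S is a set of vertices (list without repetitions)
  IsPowerDominating : List U → Set
  IsPowerDominating S = Unique S × (∀ v → Observed S v)

  data WalkIn (S : List U) : U → U → Set where
    here : ∀ {u} → WalkIn S u u
    step : ∀ {u w v} → u ∼ w → w ∈ S → WalkIn S w v → WalkIn S u v

  InducedConnected : List U → Set
  InducedConnected S = ∀ u v → u ∈ S → v ∈ S → WalkIn S u v

  IsConnectedPowerDominating : List U → Set
  IsConnectedPowerDominating S = IsPowerDominating S × InducedConnected S

  MinSize : (List U → Set) → ℕ → Set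
  MinSize P k = (Σ (List U) λ S → P S × length S ≡ k)
              × (∀ S → P S → k ≤ length S)

  γP≡ : ℕ → Set
  γP≡ = MinSize IsPowerDominating

  γPc≡ : ℕ → Set
  γPc≡ = MinSize IsConnectedPowerDominating

K : ℕ → Graph
K n = record { V = Fin n ; _~_ = λ i j → i ≢ j }

CompleteMultipartite : (k : ℕ) → (Fin k → ℕ) → Graph
CompleteMultipartite k p = record
  { V = Σ (Fin k) (λ i → Fin (p i))
  ; _~_ = λ x y → proj₁ x ≢ proj₁ y }

oneOne : (a : ℕ) → (Fin a → ℕ) → Fin (suc (suc a)) → ℕ
oneOne a m zero = 1
oneOne a m (suc zero) = 1
oneOne a m (suc (suc i)) = m i

K11 : (a : ℕ) → (Fin a → ℕ) → Graph
K11 a m = CompleteMultipartite (suc (suc a)) (oneOne a m)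

_⊗_ : Graph → Graph → Graph
G ⊗ H = record
  { V = V G × V H
  ; _~_ = λ x y → _~_ G (proj₁ x) (proj₁ y) × _~_ H (proj₂ x) (proj₂ y) }

{-# OPTIONS --safe #-}
-- Both K_n (n ≥ 3) and K_{1,1,m_1,…,m_a} (a ≥ 1) are complete multipartite graphs with at
-- least three parts, two of which are singletons {a₀}, {a₁}.  In the tensor product of two
-- such graphs a single vertex s observes nothing beyond N[s]: any vertex of N[s] ∖ {s} has
-- at least two neighbours outside N[s], found in the row and in the column of s.  Hence
-- γ_P ≥ 2.  Conversely {(a₀,b₀),(a₁,b₁)} is an edge whose closed neighbourhood misses only
-- the corners (a₀,b₁) and (a₁,b₀); the corner (a₀,b₁) is forced by (c,b₀) with c in a third
-- part, and (a₁,b₀) symmetrically.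
module Submission where

open import Defs
open import Data.Nat using (ℕ; _≤_; s≤s; z≤n)
open import Data.Fin using (Fin; zero; suc; _≟_; fromℕ<)
open import Data.Product using (Σ; ∃; _×_; _,_; proj₁; proj₂)
open import Data.Sum using (_⊎_; inj₁; inj₂)
open import Data.Empty using (⊥-elim)
open import Data.List using (List; []; _∷_; length)
open import Data.List.Relation.Unary.Any using (here; there)
open import Data.List.Relation.Unary.All using ([]; _∷_)
open import Data.List.Relation.Unary.AllPairs using ([]; _∷_)
open import Data.List.Relation.Binary.Subset.Propositional using (_⊆_)
open import Data.List.Relation.Binary.Permutation.Propositional using (↭-swap; ↭-refl)
open import Data.List.Relation.Binary.Permutation.Propositional.Properties using (∈-resp-↭)
open import Relation.Binary.Definitions using (DecidableEquality)
open import Relation.Binary.PropositionalEquality using (_≡_; _≢_; refl; sym; trans; cong; cong₂; ≢-sym)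
open import Relation.Nullary using (¬_; yes; no)

module _ (X : Graph) where

  Observed-⊆ : ∀ {S S′ v} → S ⊆ S′ → Observed X S v → Observed X S′ v
  Observed-⊆ S⊆S′ (start (inj₁ v∈S)) = start (inj₁ (S⊆S′ v∈S))
  Observed-⊆ S⊆S′ (start (inj₂ (s , s∈S , s~v))) = start (inj₂ (s , S⊆S′ s∈S , s~v))
  Observed-⊆ S⊆S′ (force ov v~w rest) =
    force (Observed-⊆ S⊆S′ ov) v~w (λ u v~u u≢w → Observed-⊆ S⊆S′ (rest u v~u u≢w))

  edge⇒InducedConnected : ∀ {u v} → _~_ X u v → _~_ X v u → InducedConnected X (u ∷ v ∷ [])
  edge⇒InducedConnected u~v v~u _ _ (here refl) (here refl) = here
  edge⇒InducedConnected u~v v~u _ _ (here refl) (there (here refl)) = step u~v (there (here refl)) here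
  edge⇒InducedConnected u~v v~u _ _ (there (here refl)) (here refl) = step v~u (here refl) here
  edge⇒InducedConnected u~v v~u _ _ (there (here refl)) (there (here refl)) = here

Multipartite : {A P : Set} → (A → P) → Graph
Multipartite {A} π = record { V = A ; _~_ = λ x y → π x ≢ π y }

AtLeastThreeParts : {A P : Set} → (A → P) → Set
AtLeastThreeParts {A} {P} π = (i j : P) → ∃ λ (x : A) → π x ≢ i × π x ≢ j

SingletonPart : {A P : Set} → (A → P) → A → Set
SingletonPart π a = ∀ x → π x ≡ π a → x ≡ a

module _ {A B PA PB : Set} (πA : A → PA) (πB : B → PB)
         (threeA : AtLeastThreeParts πA) (threeB : AtLeastThreeParts πB) where

  private
    G : Graph
    G = Multipartite πA ⊗ Multipartite πB

    _~G_ : A × B → A × B → Set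
    _~G_ = _~_ G

  module _ {s₁ : A} {s₂ : B} where

    private
      s : A × B
      s = s₁ , s₂

    ClosedNbhd : A × B → Set
    ClosedNbhd v = v ≡ s ⊎ s ~G v

    row∉ClosedNbhd : ∀ {x} → πA x ≢ πA s₁ → ¬ ClosedNbhd (x , s₂)
    row∉ClosedNbhd x≉s₁ (inj₁ e) = x≉s₁ (cong (λ v → πA (proj₁ v)) e)
    row∉ClosedNbhd _ (inj₂ (_ , s₂≉s₂)) = s₂≉s₂ refl

    column∉ClosedNbhd : ∀ {y} → πB y ≢ πB s₂ → ¬ ClosedNbhd (s₁ , y)
    column∉ClosedNbhd y≉s₂ (inj₁ e) = y≉s₂ (cong (λ v → πB (proj₂ v)) e)
    column∉ClosedNbhd _ (inj₂ (s₁≉s₁ , _)) = s₁≉s₁ refl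

    Observed-singleton⇒ClosedNbhd : ∀ {v} → Observed G (s ∷ []) v → ClosedNbhd v
    Observed-singleton⇒ClosedNbhd (start (inj₁ (here refl))) = inj₁ refl
    Observed-singleton⇒ClosedNbhd (start (inj₂ (_ , here refl , s~v))) = inj₂ s~v
    Observed-singleton⇒ClosedNbhd (force {v} {w} ov v~w rest)
      with Observed-singleton⇒ClosedNbhd ov
    ... | inj₁ refl = inj₂ v~w
    ... | inj₂ (s₁≉v₁ , s₂≉v₂) = inj₂ (s₁≉w₁ , s₂≉w₂)
      where
      s₁≉w₁ : πA s₁ ≢ πA (proj₁ w)
      s₁≉w₁ s₁≈w₁ with threeA (πA (proj₁ v)) (πA s₁)
      ... | x , x≉v₁ , x≉s₁ =
        row∉ClosedNbhd x≉s₁ (Observed-singleton⇒ClosedNbhd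
          (rest (x , s₂) (≢-sym x≉v₁ , ≢-sym s₂≉v₂)
                (λ e → x≉s₁ (trans (cong (λ u → πA (proj₁ u)) e) (sym s₁≈w₁)))))
      s₂≉w₂ : πB s₂ ≢ πB (proj₂ w)
      s₂≉w₂ s₂≈w₂ with threeB (πB (proj₂ v)) (πB s₂)
      ... | y , y≉v₂ , y≉s₂ =
        column∉ClosedNbhd y≉s₂ (Observed-singleton⇒ClosedNbhd
          (rest (s₁ , y) (≢-sym s₁≉v₁ , ≢-sym y≉v₂)
                (λ e → y≉s₂ (trans (cong (λ u → πB (proj₂ u)) e) (sym s₂≈w₂)))))

  singleton-¬PowerDominating : ∀ s → ¬ (∀ v → Observed G (s ∷ []) v)
  singleton-¬PowerDominating (s₁ , s₂) observed
    with threeB (πB s₂) (πB s₂)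
  ... | y , y≉s₂ , _ = column∉ClosedNbhd y≉s₂ (Observed-singleton⇒ClosedNbhd (observed (s₁ , y)))

  PowerDominating⇒2≤length : A × B → ∀ S → IsPowerDominating G S → 2 ≤ length S
  PowerDominating⇒2≤length s [] (_ , observed) =
    ⊥-elim (singleton-¬PowerDominating s (λ v → Observed-⊆ G (λ ()) (observed v)))
  PowerDominating⇒2≤length _ (s ∷ []) (_ , observed) = ⊥-elim (singleton-¬PowerDominating s observed)
  PowerDominating⇒2≤length _ (_ ∷ _ ∷ _) _ = s≤s (s≤s z≤n)

  module Diagonal (_≟A_ : DecidableEquality PA) (_≟B_ : DecidableEquality PB)
                  {a₀ a₁ : A} {b₀ b₁ : B} (a₀≉a₁ : πA a₀ ≢ πA a₁) (b₀≉b₁ : πB b₀ ≢ πB b₁)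
                  (single-a₀ : SingletonPart πA a₀) (single-a₁ : SingletonPart πA a₁)
                  (single-b₀ : SingletonPart πB b₀) (single-b₁ : SingletonPart πB b₁) where

    D : List (A × B)
    D = (a₀ , b₀) ∷ (a₁ , b₁) ∷ []

    private
      via₀ : ∀ {x y} → πA x ≢ πA a₀ → πB y ≢ πB b₀ → Observed G D (x , y)
      via₀ x≉a₀ y≉b₀ = start (inj₂ (_ , here refl , ≢-sym x≉a₀ , ≢-sym y≉b₀))

      via₁ : ∀ {x y} → πA x ≢ πA a₁ → πB y ≢ πB b₁ → Observed G D (x , y)
      via₁ x≉a₁ y≉b₁ = start (inj₂ (_ , there (here refl) , ≢-sym x≉a₁ , ≢-sym y≉b₁))

    Observed⊎corner : ∀ u → Observed G D u ⊎ (u ≡ (a₀ , b₁) ⊎ u ≡ (a₁ , b₀))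
    Observed⊎corner (x , y) with πA x ≟A πA a₀ | πB y ≟B πB b₀ | πA x ≟A πA a₁ | πB y ≟B πB b₁
    ... | yes x≈a₀ | yes y≈b₀ | _ | _ = inj₁ (start (inj₁ (here (cong₂ _,_ (single-a₀ x x≈a₀) (single-b₀ y y≈b₀)))))
    ... | _ | _ | yes x≈a₁ | yes y≈b₁ = inj₁ (start (inj₁ (there (here (cong₂ _,_ (single-a₁ x x≈a₁) (single-b₁ y y≈b₁))))))
    ... | no x≉a₀ | no y≉b₀ | _ | _ = inj₁ (via₀ x≉a₀ y≉b₀)
    ... | _ | _ | no x≉a₁ | no y≉b₁ = inj₁ (via₁ x≉a₁ y≉b₁)
    ... | yes x≈a₀ | _ | yes x≈a₁ | _ = ⊥-elim (a₀≉a₁ (trans (sym x≈a₀) x≈a₁))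
    ... | _ | yes y≈b₀ | _ | yes y≈b₁ = ⊥-elim (b₀≉b₁ (trans (sym y≈b₀) y≈b₁))
    ... | yes x≈a₀ | no _ | no _ | yes y≈b₁ = inj₂ (inj₁ (cong₂ _,_ (single-a₀ x x≈a₀) (single-b₁ y y≈b₁)))
    ... | no _ | yes y≈b₀ | yes x≈a₁ | no _ = inj₂ (inj₂ (cong₂ _,_ (single-a₁ x x≈a₁) (single-b₀ y y≈b₀)))

    -- (a₀,b₁) is the only unobserved neighbour of (c,b₀): the other corner shares b₀'s part.
    Observed-corner : Observed G D (a₀ , b₁)
    Observed-corner with threeA (πA a₀) (πA a₁)
    ... | c , c≉a₀ , c≉a₁ = force (via₁ c≉a₁ b₀≉b₁) (c≉a₀ , b₀≉b₁) others
      where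
      others : ∀ u → (c , b₀) ~G u → u ≢ (a₀ , b₁) → Observed G D u
      others u c~u u≢corner with Observed⊎corner u
      ... | inj₁ observed = observed
      ... | inj₂ (inj₁ refl) = ⊥-elim (u≢corner refl)
      ... | inj₂ (inj₂ refl) = ⊥-elim (proj₂ c~u refl)

  module _ (_≟A_ : DecidableEquality PA) (_≟B_ : DecidableEquality PB)
           {a₀ a₁ : A} {b₀ b₁ : B} (a₀≉a₁ : πA a₀ ≢ πA a₁) (b₀≉b₁ : πB b₀ ≢ πB b₁)
           (single-a₀ : SingletonPart πA a₀) (single-a₁ : SingletonPart πA a₁)
           (single-b₀ : SingletonPart πB b₀) (single-b₁ : SingletonPart πB b₁) where

    private
      module D₀₁ = Diagonal _≟A_ _≟B_ a₀≉a₁ b₀≉b₁ single-a₀ single-a₁ single-b₀ single-b₁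
      module D₁₀ = Diagonal _≟A_ _≟B_ (≢-sym a₀≉a₁) (≢-sym b₀≉b₁) single-a₁ single-a₀ single-b₁ single-b₀

    diagonal-ConnectedPowerDominating : IsConnectedPowerDominating G D₀₁.D
    diagonal-ConnectedPowerDominating =
      ((((λ e → a₀≉a₁ (cong (λ v → πA (proj₁ v)) e)) ∷ []) ∷ [] ∷ [] , observed)
      , edge⇒InducedConnected G (a₀≉a₁ , b₀≉b₁) (≢-sym a₀≉a₁ , ≢-sym b₀≉b₁))
      where
      observed : ∀ u → Observed G D₀₁.D u
      observed u with D₀₁.Observed⊎corner u
      ... | inj₁ o = o
      ... | inj₂ (inj₁ refl) = D₀₁.Observed-corner
      ... | inj₂ (inj₂ refl) = Observed-⊆ G (∈-resp-↭ (↭-swap _ _ ↭-refl)) D₁₀.Observed-corner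

    γPc≡2×γP≡2 : γPc≡ G 2 × γP≡ G 2
    γPc≡2×γP≡2 =
      ((D₀₁.D , diagonal-ConnectedPowerDominating , refl) , λ S cpd → lower S (proj₁ cpd))
      , ((D₀₁.D , proj₁ diagonal-ConnectedPowerDominating , refl) , lower)
      where
      lower : ∀ S → IsPowerDominating G S → 2 ≤ length S
      lower = PowerDominating⇒2≤length (a₀ , b₀)

Fin-AtLeastThreeParts : ∀ {k} → 3 ≤ k → AtLeastThreeParts {Fin k} (λ i → i)
Fin-AtLeastThreeParts (s≤s (s≤s (s≤s _))) zero zero = suc zero , (λ ()) , (λ ())
Fin-AtLeastThreeParts (s≤s (s≤s (s≤s _))) zero (suc zero) = suc (suc zero) , (λ ()) , (λ ())
Fin-AtLeastThreeParts (s≤s (s≤s (s≤s _))) zero (suc (suc _)) = suc zero , (λ ()) , (λ ())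
Fin-AtLeastThreeParts (s≤s (s≤s (s≤s _))) (suc zero) zero = suc (suc zero) , (λ ()) , (λ ())
Fin-AtLeastThreeParts (s≤s (s≤s (s≤s _))) (suc zero) (suc _) = zero , (λ ()) , (λ ())
Fin-AtLeastThreeParts (s≤s (s≤s (s≤s _))) (suc (suc _)) zero = suc zero , (λ ()) , (λ ())
Fin-AtLeastThreeParts (s≤s (s≤s (s≤s _))) (suc (suc _)) (suc _) = zero , (λ ()) , (λ ())

CompleteMultipartite-AtLeastThreeParts : ∀ {k} (p : Fin k → ℕ) → 3 ≤ k → (∀ i → Fin (p i)) →
                                         AtLeastThreeParts {Σ (Fin k) (λ i → Fin (p i))} proj₁
CompleteMultipartite-AtLeastThreeParts p 3≤k element i j with Fin-AtLeastThreeParts 3≤k i j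
... | l , l≢i , l≢j = (l , element l) , l≢i , l≢j

module _ (a : ℕ) (ms : Fin a → ℕ) where

  private
    Vertex : Set
    Vertex = V (K11 a ms)

  oneOne-element : (∀ i → 1 ≤ ms i) → ∀ i → Fin (oneOne a ms i)
  oneOne-element _ zero = zero
  oneOne-element _ (suc zero) = zero
  oneOne-element 1≤ms (suc (suc i)) = fromℕ< (1≤ms i)

  K11-singleton₀ : SingletonPart {Vertex} proj₁ (zero , zero)
  K11-singleton₀ (zero , zero) refl = refl

  K11-singleton₁ : SingletonPart {Vertex} proj₁ (suc zero , zero)
  K11-singleton₁ (suc zero , zero) refl = refl

corollary6 : (∀ (m n : ℕ) → 3 ≤ m → 3 ≤ n →
    γPc≡ (K m ⊗ K n) 2 × γP≡ (K m ⊗ K n) 2)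
    ×
    (∀ (a b : ℕ) (ms : Fin a → ℕ) (ns : Fin b → ℕ) →
    1 ≤ a → 1 ≤ b → (∀ i → 1 ≤ ms i) → (∀ j → 1 ≤ ns j) →
    γPc≡ (K11 a ms ⊗ K11 b ns) 2 × γP≡ (K11 a ms ⊗ K11 b ns) 2)
corollary6 = completeGraphs , K11s
  where
  completeGraphs : ∀ (m n : ℕ) → 3 ≤ m → 3 ≤ n → γPc≡ (K m ⊗ K n) 2 × γP≡ (K m ⊗ K n) 2
  completeGraphs _ _ 3≤m@(s≤s (s≤s (s≤s _))) 3≤n@(s≤s (s≤s (s≤s _))) =
    γPc≡2×γP≡2 (λ i → i) (λ i → i) (Fin-AtLeastThreeParts 3≤m) (Fin-AtLeastThreeParts 3≤n)
      _≟_ _≟_ {zero} {suc zero} {zero} {suc zero} (λ ()) (λ ())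
      (λ _ e → e) (λ _ e → e) (λ _ e → e) (λ _ e → e)

  K11s : ∀ (a b : ℕ) (ms : Fin a → ℕ) (ns : Fin b → ℕ) →
    1 ≤ a → 1 ≤ b → (∀ i → 1 ≤ ms i) → (∀ j → 1 ≤ ns j) →
    γPc≡ (K11 a ms ⊗ K11 b ns) 2 × γP≡ (K11 a ms ⊗ K11 b ns) 2
  K11s a b ms ns 1≤a 1≤b 1≤ms 1≤ns =
    γPc≡2×γP≡2 proj₁ proj₁
      (CompleteMultipartite-AtLeastThreeParts (oneOne a ms) (s≤s (s≤s 1≤a)) (oneOne-element a ms 1≤ms))
      (CompleteMultipartite-AtLeastThreeParts (oneOne b ns) (s≤s (s≤s 1≤b)) (oneOne-element b ns 1≤ns))
      _≟_ _≟_ (λ ()) (λ ())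
      (K11-singleton₀ a ms) (K11-singleton₁ a ms) (K11-singleton₀ b ns) (K11-singleton₁ b ns)
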